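{- Let $n,k\ge1$, let $T$ be a partition of the cells of an $n\times n$ grid into $n$ blocks of $n$ cells each, and let the cells be numbered $1,\dots,n^2$. Let $L_B,L_H,L_V$ be defined as in the context and $L_D=I_{n^2}$. Define the $k^2\times k^2$ matrices $H=I_k\otimes J_k$, $V=J_k\otimes I_k$, $B=J_{k^2}$, $D=J_{k^2}-I_{k^2}$. Then the adjacency matrix $A^{(k)}$ of the $k$-fold blow up graph $\mathrm{FSud}^{(k)}(n,T)$, with respect to the vertex numbering described in the context, equals $$A^{(k)}=L_B\otimes B+L_H\otimes H+L_V\otimes V+L_D\otimes D.$$
   Context: $I_r$ is the $r\times r$ identity, $J_r$ the $r\times r$ all-ones matrix, $\otimes$ the Kronecker product. $(L_B)_{ij}=1$ iff $i\ne j$ and cells $i,j$ lie in the same block, else $0$; $(L_H)_{ij}=1$ iff cells $i,j$ lie in the same row but in different blocks; $(L_V)_{ij}=1$ iff cells $i,j$ lie in the same column but in different blocks. The $k$-fold blow up replaces each cell $i$ by a $k\times k$ square $S_i$ of cells, giving a $kn\times kn$ grid whose block partition has, for each block $B_0\in T$, the block $\bigcup_{i\in B_0}S_i$; its graph $\mathrm{FSud}^{(k)}(n,T)$ has one vertex per cell, distinct vertices adjacent iff their cells share a row, a column or a block. The cell in relative row $a$ and relative column $b$ of $S_i$ ($a,b\in\{1,\dots,k\}$, from the top left) receives number $(i-1)k^2+(a-1)k+b$. -}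

module Defs where

open import Data.Nat using (ℕ; _*_; _+_; _∸_)
open import Data.Bool using (Bool; true; false; _∧_; _∨_; not)
open import Data.Fin using (Fin; _≟_; combine; quotient; remainder)
open import Data.Product using (_×_; _,_; proj₁; proj₂)
open import Data.List using (List; length; filter; cartesianProduct; allFin)
open import Relation.Nullary.Decidable using (⌊_⌋)
open import Function.Bundles using (_⤖_; module Bijection)
open import Relation.Binary.PropositionalEquality using (_≡_)

Mat : ℕ → Set
Mat m = Fin m → Fin m → ℕ

ind : Bool → ℕ
ind true  = 1
ind false = 0

_==_ : {m : ℕ} → Fin m → Fin m → Bool
i == j = ⌊ i ≟ j ⌋

-- cells of an m×m grid: (row , column)
Cell : ℕ → Set
Cell m = Fin m × Fin m

sameCell : {m : ℕ} → Cell m → Cell m → Bool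
sameCell (r , c) (r' , c') = (r == r') ∧ (c == c')

Id : (r : ℕ) → Mat r
Id r i j = ind (i == j)

Jm : (r : ℕ) → Mat r
Jm r i j = 1

-- Kronecker product; index x ↦ (quotient, remainder), i.e. x = q*q' + r (0-based),
-- the standard ordering of A ⊗ B
_⊗_ : {p q : ℕ} → Mat p → Mat q → Mat (p * q)
_⊗_ {p} {q} A B x y =
  A (quotient {p} q x) (quotient {p} q y) * B (remainder {p} q x) (remainder {p} q y)

_⊕_ : {m : ℕ} → Mat m → Mat m → Mat m
(A ⊕ B) x y = A x y + B x y

cells : (m : ℕ) → List (Cell m)
cells m = cartesianProduct (allFin m) (allFin m)

BlockPartition : ℕ → Set
BlockPartition n = Cell n → Fin n

Balanced : (n : ℕ) → BlockPartition n → Set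
Balanced n T = (b : Fin n) → length (filter (λ c → T c ≟ b) (cells n)) ≡ n

-- numbering of the cells: cell number i (0-based, i.e. paper's i+1)
Numbering : ℕ → Set
Numbering n = Fin (n * n) ⤖ Cell n

module _ (n : ℕ) (T : BlockPartition n) (num : Numbering n) where
  open Bijection num renaming (to to pos)

  LB : Mat (n * n)
  LB i j = ind (not (i == j) ∧ (T (pos i) == T (pos j)))

  LH : Mat (n * n)
  LH i j = ind ((proj₁ (pos i) == proj₁ (pos j)) ∧ not (T (pos i) == T (pos j)))

  LV : Mat (n * n)
  LV i j = ind ((proj₂ (pos i) == proj₂ (pos j)) ∧ not (T (pos i) == T (pos j)))

  LD : Mat (n * n)
  LD = Id (n * n)

  module _ (k : ℕ) where
    -- k-fold blow up: the (kn)×(kn) grid; big cell (R , C) lies in the square S_i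
    -- of the cell (R / k , C / k); its block is the block of that cell
    blowBlock : Cell (n * k) → Fin n
    blowBlock (R , C) = T (quotient {n} k R , quotient {n} k C)

    adjCell : Cell (n * k) → Cell (n * k) → Bool
    adjCell (R , C) (R' , C') =
      not (sameCell (R , C) (R' , C'))
      ∧ ((R == R') ∨ (C == C') ∨ (blowBlock (R , C) == blowBlock (R' , C')))

    -- vertex numbering: number i*k² + a*k + b (0-based, i.e. paper's
    -- (i-1)k²+(a-1)k+b) is the cell in relative row a, relative column b of S_i
    vertexCell : Fin ((n * n) * (k * k)) → Cell (n * k)
    vertexCell v =
      let i  = quotient {n * n} (k * k) v
          ab = remainder {n * n} (k * k) v
          a  = quotient {k} k ab
          b  = remainder {k} k ab
      in combine (proj₁ (pos i)) a , combine (proj₂ (pos i)) b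

    Ak : Mat ((n * n) * (k * k))
    Ak v w = ind (adjCell (vertexCell v) (vertexCell w))

Hm : (k : ℕ) → Mat (k * k)
Hm k = Id k ⊗ Jm k

Vm : (k : ℕ) → Mat (k * k)
Vm k = Jm k ⊗ Id k

Bm : (k : ℕ) → Mat (k * k)
Bm k = Jm (k * k)

Dm : (k : ℕ) → Mat (k * k)
Dm k i j = Jm (k * k) i j ∸ Id (k * k) i j

module Submission where

-- Write a vertex number v of the blow up as v = i·k² + r with
-- i a cell number of the original grid and r = a·k + b a position inside the
-- square S_i; the Kronecker products on the right-hand side split their
-- indices in exactly the same way, so it suffices to compare the (v , w)
-- entries for v = (i , a , b), w = (i' , a' , b').  The vertex (i , a , b)
-- occupies the big cell (x_i·k + a , y_i·k + b) where (x_i , y_i) is the cell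
-- numbered i, and its block is the block of that cell.  Hence
--   * two big rows agree iff x_i = x_i' and a = a' (and similarly for columns),
--   * the cells agree iff i = i' (the numbering is injective) and a = a', b = b'.

open import Defs
open import Data.Nat using (ℕ; _≤_; _*_; _+_; _∸_)
open import Data.Bool using (true; false; _∧_; _∨_; not)
open import Data.Product using (_,_; proj₁; proj₂)
open import Data.Fin using (Fin; _≟_; combine; quotient; remainder)
open import Data.Fin.Properties using (remQuot-combine; combine-remQuot; combine-injective)
open import Data.Empty using (⊥; ⊥-elim)
open import Function using (_∘_)
open import Function.Bundles using (module Bijection)
open import Relation.Nullary using (¬_; yes; no)
open import Relation.Nullary.Decidable using (dec-true; dec-false; isYes≗does)
open import Relation.Binary.PropositionalEquality using (_≡_; refl; cong; cong₂; sym; trans)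

≡⇒== : ∀ {m} {x y : Fin m} → x ≡ y → (x == y) ≡ true
≡⇒== {x = x} {y} x≡y = trans (isYes≗does (x ≟ y)) (dec-true (x ≟ y) x≡y)

≢⇒== : ∀ {m} {x y : Fin m} → ¬ (x ≡ y) → (x == y) ≡ false
≢⇒== {x = x} {y} x≢y = trans (isYes≗does (x ≟ y)) (dec-false (x ≟ y) x≢y)

==⇒≡ : ∀ {m} {x y : Fin m} → (x == y) ≡ true → x ≡ y
==⇒≡ {x = x} {y} eq with x ≟ y | eq
... | yes x≡y | _ = x≡y
... | no _    | ()

combine-== : ∀ {m l} (x : Fin m) (a : Fin l) (y : Fin m) (b : Fin l) →
  (combine x a == combine y b) ≡ ((x == y) ∧ (a == b))
combine-== x a y b with x ≟ y | a ≟ b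
... | yes refl | yes refl = ≡⇒== refl
... | yes _    | no a≢b   = ≢⇒== (a≢b ∘ proj₂ ∘ combine-injective x a y b)
... | no x≢y   | _        = ≢⇒== (x≢y ∘ proj₁ ∘ combine-injective x a y b)

split-== : ∀ {m} l (r r' : Fin (m * l)) →
  (r == r') ≡ ((quotient {m} l r == quotient {m} l r') ∧ (remainder {m} l r == remainder {m} l r'))
split-== {m} l r r' =
  trans (cong₂ _==_ (sym (combine-remQuot {m} l r)) (sym (combine-remQuot {m} l r')))
        (combine-== (quotient {m} l r) (remainder {m} l r) (quotient {m} l r') (remainder {m} l r'))

quotient-combine : ∀ {m} l (x : Fin m) (a : Fin l) → quotient {m} l (combine x a) ≡ x
quotient-combine l x a = cong proj₁ (remQuot-combine x a)

-- With X, Y for "same row /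
-- column of the original grid", A, B for "same relative row / column inside
-- the squares" and S for "same block", the adjacency formula of the blow up
-- equals the (i , i') entry of the right-hand side.

-- Same original cell (X = Y = S = true): only the L_D ⊗ D term survives.
diagonal-entry : ∀ {X Y S} A B → X ≡ true → Y ≡ true → S ≡ true →
  ind (not ((X ∧ A) ∧ (Y ∧ B)) ∧ ((X ∧ A) ∨ (Y ∧ B) ∨ S))
  ≡ ind (not true ∧ S) * 1 + ind (X ∧ not S) * (ind A * 1)
    + (ind (Y ∧ not S) * (1 * ind B) + ind true * (1 ∸ ind (A ∧ B)))
diagonal-entry true  true  refl refl refl = refl
diagonal-entry true  false refl refl refl = refl
diagonal-entry false true  refl refl refl = refl
diagonal-entry false false refl refl refl = refl

off-diagonal-entry : ∀ X Y A B S → (X ≡ true → Y ≡ true → ⊥) →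
  ind (not ((X ∧ A) ∧ (Y ∧ B)) ∧ ((X ∧ A) ∨ (Y ∧ B) ∨ S))
  ≡ ind (not false ∧ S) * 1 + ind (X ∧ not S) * (ind A * 1)
    + (ind (Y ∧ not S) * (1 * ind B) + ind false * (1 ∸ ind (A ∧ B)))
off-diagonal-entry true  true  _     _     _     distinct = ⊥-elim (distinct refl refl)
off-diagonal-entry true  false true  _     true  _ = refl
off-diagonal-entry true  false true  _     false _ = refl
off-diagonal-entry true  false false _     true  _ = refl
off-diagonal-entry true  false false _     false _ = refl
off-diagonal-entry false true  _     true  true  _ = refl
off-diagonal-entry false true  _     true  false _ = refl
off-diagonal-entry false true  _     false true  _ = refl
off-diagonal-entry false true  _     false false _ = refl
off-diagonal-entry false false _     _     true  _ = refl
off-diagonal-entry false false _     _     false _ = refl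

module BlowUp (n : ℕ) (T : BlockPartition n) (num : Numbering n) (k : ℕ) where
  open Bijection num using (injective) renaming (to to pos)

  row col : Fin (n * n) → Fin n
  row i = proj₁ (pos i)
  col i = proj₂ (pos i)

  -- The big cell of the vertex with position r = a·k + b inside the square S_i;
  -- 'vertexCell' of the vertex number i·k² + r is definitionally this cell.
  bigCell : Fin (n * n) → Fin (k * k) → Cell (n * k)
  bigCell i r = combine (row i) (quotient {k} k r) , combine (col i) (remainder {k} k r)

  same-position : ∀ {i i'} → (row i == row i') ≡ true → (col i == col i') ≡ true → i ≡ i'
  same-position sameRow sameCol = injective (cong₂ _,_ (==⇒≡ sameRow) (==⇒≡ sameCol))

  adjCell-bigCell : ∀ i i' r r' →
    adjCell n T num k (bigCell i r) (bigCell i' r')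
    ≡ (not (((row i == row i') ∧ (quotient {k} k r == quotient {k} k r'))
           ∧ ((col i == col i') ∧ (remainder {k} k r == remainder {k} k r')))
       ∧ (((row i == row i') ∧ (quotient {k} k r == quotient {k} k r'))
          ∨ ((col i == col i') ∧ (remainder {k} k r == remainder {k} k r'))
          ∨ (T (pos i) == T (pos i'))))
  adjCell-bigCell i i' r r'
    rewrite quotient-combine k (row i) (quotient {k} k r)
          | quotient-combine k (col i) (remainder {k} k r)
          | quotient-combine k (row i') (quotient {k} k r')
          | quotient-combine k (col i') (remainder {k} k r')
          | combine-== (row i) (quotient {k} k r) (row i') (quotient {k} k r')
          | combine-== (col i) (remainder {k} k r) (col i') (remainder {k} k r')
          = refl

  entry : ∀ i i' r r' →
    ind (adjCell n T num k (bigCell i r) (bigCell i' r'))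
    ≡ LB n T num i i' * Bm k r r' + LH n T num i i' * Hm k r r'
      + (LV n T num i i' * Vm k r r' + LD n T num i i' * Dm k r r')
  entry i i' r r' rewrite adjCell-bigCell i i' r r' | split-== {k} k r r' with i ≟ i'
  ... | yes refl = diagonal-entry sameRelRow sameRelCol
                     (≡⇒== {x = row i} refl) (≡⇒== {x = col i} refl) (≡⇒== {x = T (pos i)} refl)
    where
    sameRelRow = quotient {k} k r == quotient {k} k r'
    sameRelCol = remainder {k} k r == remainder {k} k r'
  ... | no i≢i'  = off-diagonal-entry (row i == row i') (col i == col i')
                     (quotient {k} k r == quotient {k} k r') (remainder {k} k r == remainder {k} k r')
                     (T (pos i) == T (pos i'))
                     (λ sameRow sameCol → i≢i' (same-position sameRow sameCol))

-- Proposition 5: both sides split the vertex numbers v, w into a cell number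
-- (quotient by k²) and a position in the square (remainder), so the claim is
-- the entry formula above.
proposition5 : (n k : ℕ) → 1 ≤ n → 1 ≤ k →
    (T : BlockPartition n) → Balanced n T → (num : Numbering n) →
    ∀ v w → Ak n T num k v w
      ≡ (((LB n T num ⊗ Bm k) ⊕ (LH n T num ⊗ Hm k)) ⊕ ((LV n T num ⊗ Vm k) ⊕ (LD n T num ⊗ Dm k))) v w
proposition5 n k _ _ T _ num v w =
  BlowUp.entry n T num k (quotient {n * n} (k * k) v) (quotient {n * n} (k * k) w)
                         (remainder {n * n} (k * k) v) (remainder {n * n} (k * k) w)
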